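{- Let $0\le r_1\le 2$ and $0\le r_{2k+1}\le 2$. Let $P=v_1v_2\dots v_{2k+1}$ be a path on an odd number of vertices, where $k\ge 1$, and let $F:V(P)\to 2^{\{1,\dots,14\}}$. If $|F(v_j)|\le 3+r_j$ for $j\in\{1,2k+1\}$, $|F(v_i)|=2$ for all $2\le i\le 2k$, $|F(v_1)\cap F(v_2)|\le r_1$, and $|F(v_{2k})\cap F(v_{2k+1})|\le r_{2k+1}$, then there is an $F$-avoiding coloring $f$ of $P$ such that $|f(v_j)|=6$ for every $2\le j\le 2k$ and $|f(v_j)|=8-r_j$ for $j\in\{1,2k+1\}$.
   Context: Given $F:V(P)\to 2^{\{1,\dots,14\}}$, a function $f:V(P)\to 2^{\{1,\dots,14\}}$ is an $F$-avoiding coloring of $P$ if $f(v)$ is disjoint from $F(v)\cup f(u)$ for every pair of adjacent vertices $u,v$ of $P$. -}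

module Defs where

open import Data.Nat using (ℕ; suc; _+_)
open import Data.Fin using (Fin; toℕ)
open import Data.Fin.Subset using (Subset; _∩_; _∪_; Empty)
open import Data.Sum using (_⊎_)
open import Relation.Binary.PropositionalEquality using (_≡_)

-- Colour palette {1,…,14} is represented by Fin 14; subsets of it by Subset 14.
Colours : Set
Colours = Subset 14

-- The path P = v₁ v₂ … vₙ on n vertices; vertex vᵢ is represented by
-- the element (i-1) of Fin n.  Vertices u, v are adjacent iff their
-- indices differ by exactly one.
Adjacent : {n : ℕ} → Fin n → Fin n → Set
Adjacent u v = (toℕ u + 1 ≡ toℕ v) ⊎ (toℕ v + 1 ≡ toℕ u)

Disjoint : Colours → Colours → Set
Disjoint A B = Empty (A ∩ B)

FAvoiding : {n : ℕ} → (F f : Fin n → Colours) → Set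
FAvoiding {n} F f = (u v : Fin n) → Adjacent u v → Disjoint (f v) (F v ∪ f u)

module Submission where

-- Colouring the path v₀ v₁ … v_L with L = 2k (vᵢ is the paper's vᵢ₊₁) while
-- avoiding the lists F.
--
-- The proof is by induction on k and removes the two leftmost vertices.
-- Let S₀ be a set of |F(v₀)| ∸ r colours of F(v₀) ∖ F(v₁); it has at most 3
-- elements and the colour f(v₁) must contain it, so that f(v₀) (of size 8 ∸ r)
-- fits beside f(v₁).  Adding S₀ to the list of v₂ gives a list of size at most
-- 5 = 3 + 2, so the path v₂ … v_L is an instance of the statement with r = 2;
-- its colouring gives f(v₂) of size 6, then f(v₁) ⊇ S₀ of size 6 avoiding
-- F(v₁) ∪ f(v₂) (at most 8 colours), and finally f(v₀).  For k = 1 the middle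
-- colour has to contain the reserved sets of both ends.

open import Defs
open import Data.Nat using (ℕ; suc; _+_; _*_; _∸_; _≤_; _<_)
open import Data.Fin using (Fin; toℕ; zero; fromℕ)
open import Data.Fin.Subset using (∣_∣; _∩_)
open import Data.Product using (Σ; _×_)
open import Relation.Binary.PropositionalEquality using (_≡_)

open import Data.Nat using (zero; z≤n; s≤s)
open import Data.Nat.Properties
open import Data.Fin using (suc)
open import Data.Fin.Properties using (toℕ-fromℕ)
open import Data.Fin.Subset using (Subset; _∪_; ∁; ⊥; _⊆_; Empty; inside; outside)
open import Data.Fin.Subset.Properties
open import Data.Vec.Base using ([]; _∷_)
open import Data.Product using (_,_; proj₁; proj₂)
open import Data.Sum using (inj₁; inj₂; [_,_])
open import Function using (_∘_)
open import Relation.Binary.PropositionalEquality using (refl; sym; trans; cong; cong₂; subst; module ≡-Reasoning)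

∣p∪q∣+∣p∩q∣≡∣p∣+∣q∣ : ∀ {n} (p q : Subset n) → ∣ p ∪ q ∣ + ∣ p ∩ q ∣ ≡ ∣ p ∣ + ∣ q ∣
∣p∪q∣+∣p∩q∣≡∣p∣+∣q∣ [] [] = refl
∣p∪q∣+∣p∩q∣≡∣p∣+∣q∣ (inside ∷ p) (inside ∷ q) =
  cong suc (trans (+-suc _ _) (trans (cong suc (∣p∪q∣+∣p∩q∣≡∣p∣+∣q∣ p q)) (sym (+-suc _ _))))
∣p∪q∣+∣p∩q∣≡∣p∣+∣q∣ (inside ∷ p) (outside ∷ q) = cong suc (∣p∪q∣+∣p∩q∣≡∣p∣+∣q∣ p q)
∣p∪q∣+∣p∩q∣≡∣p∣+∣q∣ (outside ∷ p) (inside ∷ q) =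
  trans (cong suc (∣p∪q∣+∣p∩q∣≡∣p∣+∣q∣ p q)) (sym (+-suc _ _))
∣p∪q∣+∣p∩q∣≡∣p∣+∣q∣ (outside ∷ p) (outside ∷ q) = ∣p∪q∣+∣p∩q∣≡∣p∣+∣q∣ p q

∣p∪q∣≤∣p∣+∣q∣ : ∀ {n} (p q : Subset n) → ∣ p ∪ q ∣ ≤ ∣ p ∣ + ∣ q ∣
∣p∪q∣≤∣p∣+∣q∣ p q = ≤-trans (m≤m+n _ _) (≤-reflexive (∣p∪q∣+∣p∩q∣≡∣p∣+∣q∣ p q))

∣p∪q∣≡∣p∣+∣q∣ : ∀ {n} (p q : Subset n) → Empty (p ∩ q) → ∣ p ∪ q ∣ ≡ ∣ p ∣ + ∣ q ∣
∣p∪q∣≡∣p∣+∣q∣ {n} p q p∩q-empty = begin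
  ∣ p ∪ q ∣                ≡⟨ sym (+-identityʳ _) ⟩
  ∣ p ∪ q ∣ + 0            ≡⟨ cong (∣ p ∪ q ∣ +_) (∣⊥∣≡0 n) ⟨
  ∣ p ∪ q ∣ + ∣ ⊥ {n} ∣    ≡⟨ cong (λ s → ∣ p ∪ q ∣ + ∣ s ∣) (Empty-unique p∩q-empty) ⟨
  ∣ p ∪ q ∣ + ∣ p ∩ q ∣    ≡⟨ ∣p∪q∣+∣p∩q∣≡∣p∣+∣q∣ p q ⟩
  ∣ p ∣ + ∣ q ∣            ∎
  where open ≡-Reasoning

∣p∩∁q∣+∣p∩q∣≡∣p∣ : ∀ {n} (p q : Subset n) → ∣ p ∩ ∁ q ∣ + ∣ p ∩ q ∣ ≡ ∣ p ∣
∣p∩∁q∣+∣p∩q∣≡∣p∣ [] [] = refl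
∣p∩∁q∣+∣p∩q∣≡∣p∣ (inside ∷ p) (inside ∷ q) = trans (+-suc _ _) (cong suc (∣p∩∁q∣+∣p∩q∣≡∣p∣ p q))
∣p∩∁q∣+∣p∩q∣≡∣p∣ (inside ∷ p) (outside ∷ q) = cong suc (∣p∩∁q∣+∣p∩q∣≡∣p∣ p q)
∣p∩∁q∣+∣p∩q∣≡∣p∣ (outside ∷ p) (_ ∷ q) = ∣p∩∁q∣+∣p∩q∣≡∣p∣ p q

subsetOfSize : ∀ {n} (A : Subset n) {m : ℕ} → m ≤ ∣ A ∣ → Σ (Subset n) λ B → B ⊆ A × ∣ B ∣ ≡ m
subsetOfSize {n} A {zero} _ = ⊥ , ⊥⊆ , ∣⊥∣≡0 n
subsetOfSize [] {suc m} ()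
subsetOfSize (inside ∷ A) {suc m} (s≤s m≤∣A∣) =
  let B , B⊆A , ∣B∣≡m = subsetOfSize A m≤∣A∣ in inside ∷ B , s⊆s B⊆A , cong suc ∣B∣≡m
subsetOfSize (outside ∷ A) {suc m} m≤∣A∣ =
  let B , B⊆A , ∣B∣≡m = subsetOfSize A m≤∣A∣ in outside ∷ B , s⊆s B⊆A , ∣B∣≡m

-- Between S ⊆ A there are sets of every size from ∣ S ∣ to ∣ A ∣:
-- add to S a subset of A ∖ S of the missing size.
sandwich : ∀ {n} (A S : Subset n) {m : ℕ} → S ⊆ A → ∣ S ∣ ≤ m → m ≤ ∣ A ∣ →
           Σ (Subset n) λ B → S ⊆ B × B ⊆ A × ∣ B ∣ ≡ m
sandwich A S {m} S⊆A ∣S∣≤m m≤∣A∣ =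
  let T , T⊆A∖S , ∣T∣≡ = subsetOfSize (A ∩ ∁ S) room
      T⊆A : T ⊆ A
      T⊆A x∈T = proj₁ (x∈p∩q⁻ A (∁ S) (T⊆A∖S x∈T))
      T⊆∁S : T ⊆ ∁ S
      T⊆∁S x∈T = proj₂ (x∈p∩q⁻ A (∁ S) (T⊆A∖S x∈T))
      S∩T-empty : Empty (S ∩ T)
      S∩T-empty = λ (x , x∈S∩T) →
        let x∈S , x∈T = x∈p∩q⁻ S T x∈S∩T in x∈∁p⇒x∉p (T⊆∁S x∈T) x∈S
  in S ∪ T , p⊆p∪q T
   , (λ x∈S∪T → [ S⊆A , T⊆A ] (x∈p∪q⁻ S T x∈S∪T))
   , trans (∣p∪q∣≡∣p∣+∣q∣ S T S∩T-empty) (trans (cong (∣ S ∣ +_) ∣T∣≡) (m+[n∸m]≡n ∣S∣≤m))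
  where
  -- ∣ A ∣ ≤ ∣ A ∖ S ∣ + ∣ S ∣, so the missing m ∸ ∣ S ∣ elements fit into A ∖ S
  room : m ∸ ∣ S ∣ ≤ ∣ A ∩ ∁ S ∣
  room = m≤n+o⇒m∸n≤o m ∣ S ∣ (begin
    m                           ≤⟨ m≤∣A∣ ⟩
    ∣ A ∣                       ≡⟨ ∣p∩∁q∣+∣p∩q∣≡∣p∣ A S ⟨
    ∣ A ∩ ∁ S ∣ + ∣ A ∩ S ∣     ≤⟨ +-monoʳ-≤ ∣ A ∩ ∁ S ∣ (∣p∩q∣≤∣q∣ A S) ⟩
    ∣ A ∩ ∁ S ∣ + ∣ S ∣         ≡⟨ +-comm _ ∣ S ∣ ⟩
    ∣ S ∣ + ∣ A ∩ ∁ S ∣         ∎)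
    where open ≤-Reasoning

⊆∁⇒disjoint : {A B : Colours} → A ⊆ ∁ B → Disjoint A B
⊆∁⇒disjoint {A} {B} A⊆∁B (x , x∈A∩B) =
  let x∈A , x∈B = x∈p∩q⁻ A B x∈A∩B in x∈∁p⇒x∉p (A⊆∁B x∈A) x∈B

disjoint⇒⊆∁ : {A B : Colours} → Disjoint A B → A ⊆ ∁ B
disjoint⇒⊆∁ A⟂B x∈A = x∉p⇒x∈∁p λ x∈B → A⟂B (_ , x∈p∩q⁺ (x∈A , x∈B))

disjoint-⊆ : {A A′ B B′ : Colours} → A′ ⊆ A → B′ ⊆ B → Disjoint A B → Disjoint A′ B′
disjoint-⊆ {A′ = A′} {B′ = B′} A′⊆A B′⊆B A⟂B (x , x∈A′∩B′) =
  let x∈A′ , x∈B′ = x∈p∩q⁻ A′ B′ x∈A′∩B′ in A⟂B (x , x∈p∩q⁺ (A′⊆A x∈A′ , B′⊆B x∈B′))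

disjoint-sym : {A B : Colours} → Disjoint A B → Disjoint B A
disjoint-sym {A} {B} A⟂B (x , x∈B∩A) =
  let x∈B , x∈A = x∈p∩q⁻ B A x∈B∩A in A⟂B (x , x∈p∩q⁺ (x∈A , x∈B))

disjoint-∪ : {A B C : Colours} → Disjoint A B → Disjoint A C → Disjoint A (B ∪ C)
disjoint-∪ {A} {B} {C} A⟂B A⟂C (x , x∈A∩B∪C) =
  let x∈A , x∈B∪C = x∈p∩q⁻ A (B ∪ C) x∈A∩B∪C in
  [ (λ x∈B → A⟂B (x , x∈p∩q⁺ (x∈A , x∈B))) , (λ x∈C → A⟂C (x , x∈p∩q⁺ (x∈A , x∈C))) ]
    (x∈p∪q⁻ B C x∈B∪C)

⊥-disjoint : {A : Colours} → Disjoint ⊥ A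
⊥-disjoint {A} (x , x∈⊥∩A) = ∉⊥ (proj₁ (x∈p∩q⁻ ⊥ A x∈⊥∩A))

reserved≤ : {e r : ℕ} (t : ℕ) → e ≤ t + r → e ∸ r ≤ t
reserved≤ {e} {r} t e≤t+r = m≤n+o⇒m∸n≤o e r (subst (e ≤_) (+-comm t r) e≤t+r)

reservedPart : (E N : Colours) (r : ℕ) → ∣ E ∩ N ∣ ≤ r →
               Σ Colours λ S → S ⊆ E × Disjoint S N × ∣ S ∣ ≡ ∣ E ∣ ∸ r
reservedPart E N r ∣E∩N∣≤r =
  let S , S⊆E∖N , ∣S∣≡ = subsetOfSize (E ∩ ∁ N) room in
  S , ⊆-trans S⊆E∖N (p∩q⊆p E (∁ N)) , ⊆∁⇒disjoint (⊆-trans S⊆E∖N (p∩q⊆q E (∁ N))) , ∣S∣≡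
  where
  room : ∣ E ∣ ∸ r ≤ ∣ E ∩ ∁ N ∣
  room = m≤n+o⇒m∸n≤o ∣ E ∣ r (begin
    ∣ E ∣                      ≡⟨ ∣p∩∁q∣+∣p∩q∣≡∣p∣ E N ⟨
    ∣ E ∩ ∁ N ∣ + ∣ E ∩ N ∣    ≤⟨ +-monoʳ-≤ ∣ E ∩ ∁ N ∣ ∣E∩N∣≤r ⟩
    ∣ E ∩ ∁ N ∣ + r            ≡⟨ +-comm _ r ⟩
    r + ∣ E ∩ ∁ N ∣            ∎)
    where open ≤-Reasoning

coverage : {E X S : Colours} {r : ℕ} → S ⊆ E → S ⊆ X → ∣ S ∣ ≡ ∣ E ∣ ∸ r →
           ∣ E ∣ ∸ r ≤ ∣ E ∩ X ∣
coverage S⊆E S⊆X ∣S∣≡ = subst (_≤ _) ∣S∣≡ (p⊆q⇒∣p∣≤∣q∣ λ x∈S → x∈p∩q⁺ (S⊆E x∈S , S⊆X x∈S))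

-- A middle colour: a set S of at most 6 colours avoiding B (∣ B ∣ ≤ 8) grows to
-- a 6-set avoiding B, since B leaves 6 of the 14 colours free.
middleColour : (B S : Colours) → ∣ B ∣ ≤ 8 → ∣ S ∣ ≤ 6 → Disjoint S B →
               Σ Colours λ X → S ⊆ X × Disjoint X B × ∣ X ∣ ≡ 6
middleColour B S ∣B∣≤8 ∣S∣≤6 S⟂B =
  let X , S⊆X , X⊆∁B , ∣X∣≡6 = sandwich (∁ B) S (disjoint⇒⊆∁ S⟂B) ∣S∣≤6 free in
  X , S⊆X , ⊆∁⇒disjoint X⊆∁B , ∣X∣≡6
  where
  free : 6 ≤ ∣ ∁ B ∣
  free = subst (6 ≤_) (sym (∣∁p∣≡n∸∣p∣ B)) (∸-monoʳ-≤ 14 ∣B∣≤8)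

-- An end colour: if the 6-set X covers all but r colours of the list E, then
-- E ∪ X has at most 6 + r colours, leaving 8 ∸ r colours that avoid both.
endColour : (E X : Colours) (r : ℕ) → ∣ X ∣ ≡ 6 → ∣ E ∣ ∸ r ≤ ∣ E ∩ X ∣ →
            Σ Colours λ f → Disjoint f E × Disjoint f X × ∣ f ∣ ≡ 8 ∸ r
endColour E X r ∣X∣≡6 covered =
  let f , f⊆∁E∪X , ∣f∣≡ = subsetOfSize (∁ (E ∪ X)) free
      f⟂E∪X = ⊆∁⇒disjoint f⊆∁E∪X
  in f , disjoint-⊆ ⊆-refl (p⊆p∪q X) f⟂E∪X , disjoint-⊆ ⊆-refl (q⊆p∪q E X) f⟂E∪X , ∣f∣≡
  where
  open ≤-Reasoning
  ∣E∪X∣≤6+r : ∣ E ∪ X ∣ ≤ 6 + r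
  ∣E∪X∣≤6+r = +-cancelʳ-≤ ∣ E ∩ X ∣ _ _ (begin
    ∣ E ∪ X ∣ + ∣ E ∩ X ∣    ≡⟨ ∣p∪q∣+∣p∩q∣≡∣p∣+∣q∣ E X ⟩
    ∣ E ∣ + ∣ X ∣            ≡⟨ cong (∣ E ∣ +_) ∣X∣≡6 ⟩
    ∣ E ∣ + 6                ≤⟨ +-monoˡ-≤ 6 (≤-trans (m≤n+m∸n ∣ E ∣ r) (+-monoʳ-≤ r covered)) ⟩
    r + ∣ E ∩ X ∣ + 6        ≡⟨ +-comm (r + ∣ E ∩ X ∣) 6 ⟩
    6 + (r + ∣ E ∩ X ∣)      ≡⟨ +-assoc 6 r _ ⟨
    6 + r + ∣ E ∩ X ∣        ∎)
  free : 8 ∸ r ≤ ∣ ∁ (E ∪ X) ∣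
  free = begin
    8 ∸ r              ≡⟨ ∸-+-assoc 14 6 r ⟩
    14 ∸ (6 + r)       ≤⟨ ∸-monoʳ-≤ 14 ∣E∪X∣≤6+r ⟩
    14 ∸ ∣ E ∪ X ∣     ≡⟨ ∣∁p∣≡n∸∣p∣ (E ∪ X) ⟨
    ∣ ∁ (E ∪ X) ∣      ∎

-- Paths indexed by ℕ.  The vertices are 0, 1, …, L; lists and colours are
-- functions on ℕ whose values beyond L play no role.

record PathColouring (L r s : ℕ) (F : ℕ → Colours) : Set where
  field
    colour     : ℕ → Colours
    avoidsList : (i : ℕ) → Disjoint (colour i) (F i)
    avoidsNext : (i : ℕ) → Disjoint (colour i) (colour (suc i))
    innerSize  : (i : ℕ) → 1 ≤ i → i < L → ∣ colour i ∣ ≡ 6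
    leftSize   : ∣ colour 0 ∣ ≡ 8 ∸ r
    rightSize  : ∣ colour L ∣ ≡ 8 ∸ s

open PathColouring

prepend₂ : Colours → Colours → (ℕ → Colours) → ℕ → Colours
prepend₂ a b g 0 = a
prepend₂ a b g 1 = b
prepend₂ a b g (suc (suc i)) = g i

prepend₂-avoidsList : {F : ℕ → Colours} {a b : Colours} {g : ℕ → Colours} →
  Disjoint a (F 0) → Disjoint b (F 1) → ((i : ℕ) → Disjoint (g i) (F (suc (suc i)))) →
  (i : ℕ) → Disjoint (prepend₂ a b g i) (F i)
prepend₂-avoidsList a⟂F₀ b⟂F₁ g⟂F 0 = a⟂F₀
prepend₂-avoidsList a⟂F₀ b⟂F₁ g⟂F 1 = b⟂F₁
prepend₂-avoidsList a⟂F₀ b⟂F₁ g⟂F (suc (suc i)) = g⟂F i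

prepend₂-avoidsNext : {a b : Colours} {g : ℕ → Colours} →
  Disjoint a b → Disjoint b (g 0) → ((i : ℕ) → Disjoint (g i) (g (suc i))) →
  (i : ℕ) → Disjoint (prepend₂ a b g i) (prepend₂ a b g (suc i))
prepend₂-avoidsNext a⟂b b⟂g₀ g⟂g 0 = a⟂b
prepend₂-avoidsNext a⟂b b⟂g₀ g⟂g 1 = b⟂g₀
prepend₂-avoidsNext a⟂b b⟂g₀ g⟂g (suc (suc i)) = g⟂g i

tailLists : Colours → (ℕ → Colours) → ℕ → Colours
tailLists X F 0 = X
tailLists X F (suc i) = F (suc (suc (suc i)))

extendColouring : {L r s : ℕ} (F : ℕ → Colours) (S₀ : Colours) →
  ∣ F 1 ∣ ≡ 2 → S₀ ⊆ F 0 → Disjoint S₀ (F 1) → ∣ S₀ ∣ ≡ ∣ F 0 ∣ ∸ r → ∣ S₀ ∣ ≤ 6 →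
  PathColouring L 2 s (tailLists (F 2 ∪ S₀) F) → PathColouring (suc (suc L)) r s F
extendColouring {r = r} F S₀ ∣F₁∣≡2 S₀⊆F₀ S₀⟂F₁ ∣S₀∣≡ ∣S₀∣≤6 g =
  let f₁ , S₀⊆f₁ , f₁⟂F₁∪g₀ , ∣f₁∣≡6 =
        middleColour (F 1 ∪ colour g 0) S₀ room ∣S₀∣≤6 (disjoint-∪ S₀⟂F₁ S₀⟂g₀)
      f₀ , f₀⟂F₀ , f₀⟂f₁ , ∣f₀∣≡ = endColour (F 0) f₁ r ∣f₁∣≡6 (coverage {r = r} S₀⊆F₀ S₀⊆f₁ ∣S₀∣≡)
  in record
    { colour     = prepend₂ f₀ f₁ (colour g)
    ; avoidsList = prepend₂-avoidsList f₀⟂F₀ (disjoint-⊆ ⊆-refl (p⊆p∪q _) f₁⟂F₁∪g₀) g⟂F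
    ; avoidsNext = prepend₂-avoidsNext f₀⟂f₁ (disjoint-⊆ ⊆-refl (q⊆p∪q _ _) f₁⟂F₁∪g₀) (avoidsNext g)
    ; innerSize  = λ { zero () _
                     ; 1 _ _ → ∣f₁∣≡6
                     ; 2 _ _ → leftSize g
                     ; (suc (suc (suc i))) _ (s≤s (s≤s i<L)) → innerSize g (suc i) (s≤s z≤n) i<L }
    ; leftSize   = ∣f₀∣≡
    ; rightSize  = rightSize g
    }
  where
  S₀⟂g₀ : Disjoint S₀ (colour g 0)
  S₀⟂g₀ = disjoint-sym (disjoint-⊆ ⊆-refl (q⊆p∪q (F 2) S₀) (avoidsList g 0))
  room : ∣ F 1 ∪ colour g 0 ∣ ≤ 8
  room = ≤-trans (∣p∪q∣≤∣p∣+∣q∣ (F 1) (colour g 0)) (≤-reflexive (cong₂ _+_ ∣F₁∣≡2 (leftSize g)))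
  g⟂F : (i : ℕ) → Disjoint (colour g i) (F (suc (suc i)))
  g⟂F zero    = disjoint-⊆ ⊆-refl (p⊆p∪q S₀) (avoidsList g 0)
  g⟂F (suc i) = avoidsList g (suc i)

-- double m = 2 m, by a recursion along which the induction below computes.
double : ℕ → ℕ
double zero    = zero
double (suc m) = suc (suc (double m))

-- The lemma for ℕ-indexed paths 0 … L with L = 2 m + 2, by induction on m.
colourPath : (m : ℕ) {L : ℕ} → suc (suc (double m)) ≡ L → (r s : ℕ) (F : ℕ → Colours) →
  ∣ F 0 ∣ ≤ 3 + r → ∣ F L ∣ ≤ 3 + s → ((i : ℕ) → 1 ≤ i → i < L → ∣ F i ∣ ≡ 2) →
  ∣ F 0 ∩ F 1 ∣ ≤ r → ((i : ℕ) → i + 1 ≡ L → ∣ F i ∩ F L ∣ ≤ s) →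
  PathColouring L r s F
-- Three vertices: the middle colour contains the reserved parts of both ends.
colourPath zero refl r s F ∣F₀∣≤ ∣F₂∣≤ inner left right =
  let S₀ , S₀⊆F₀ , S₀⟂F₁ , ∣S₀∣≡ = reservedPart (F 0) (F 1) r left
      S₂ , S₂⊆F₂ , S₂⟂F₁ , ∣S₂∣≡ = reservedPart (F 2) (F 1) s
                                      (subst (_≤ s) (cong ∣_∣ (∩-comm (F 1) (F 2))) (right 1 refl))
      ∣S₀∪S₂∣≤6 = ≤-trans (∣p∪q∣≤∣p∣+∣q∣ S₀ S₂)
                    (+-mono-≤ (subst (_≤ 3) (sym ∣S₀∣≡) (reserved≤ 3 ∣F₀∣≤))
                              (subst (_≤ 3) (sym ∣S₂∣≡) (reserved≤ 3 ∣F₂∣≤)))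
      f₁ , S₀∪S₂⊆f₁ , f₁⟂F₁ , ∣f₁∣≡6 =
        middleColour (F 1) (S₀ ∪ S₂) (≤-trans (≤-reflexive ∣F₁∣≡2) (s≤s (s≤s z≤n))) ∣S₀∪S₂∣≤6
          (disjoint-sym (disjoint-∪ (disjoint-sym S₀⟂F₁) (disjoint-sym S₂⟂F₁)))
      f₀ , f₀⟂F₀ , f₀⟂f₁ , ∣f₀∣≡ = endColour (F 0) f₁ r ∣f₁∣≡6
        (coverage {r = r} S₀⊆F₀ (⊆-trans (p⊆p∪q S₂) S₀∪S₂⊆f₁) ∣S₀∣≡)
      f₂ , f₂⟂F₂ , f₂⟂f₁ , ∣f₂∣≡ = endColour (F 2) f₁ s ∣f₁∣≡6
        (coverage {r = s} S₂⊆F₂ (⊆-trans (q⊆p∪q S₀ S₂) S₀∪S₂⊆f₁) ∣S₂∣≡)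
      only-f₂ : ℕ → Colours
      only-f₂ = λ { zero → f₂ ; (suc _) → ⊥ }
  in record
    { colour     = prepend₂ f₀ f₁ only-f₂
    ; avoidsList = prepend₂-avoidsList f₀⟂F₀ f₁⟂F₁ λ { zero → f₂⟂F₂ ; (suc _) → ⊥-disjoint }
    ; avoidsNext = prepend₂-avoidsNext f₀⟂f₁ (disjoint-sym f₂⟂f₁)
                     λ { zero → disjoint-sym ⊥-disjoint ; (suc _) → ⊥-disjoint {⊥} }
    ; innerSize  = λ { zero () _ ; 1 _ _ → ∣f₁∣≡6 ; (suc (suc _)) _ (s≤s (s≤s ())) }
    ; leftSize   = ∣f₀∣≡
    ; rightSize  = ∣f₂∣≡
    }
  where
  ∣F₁∣≡2 : ∣ F 1 ∣ ≡ 2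
  ∣F₁∣≡2 = inner 1 (s≤s z≤n) (s≤s (s≤s z≤n))
-- Longer paths: reserve S₀ at vertex 0, colour the tail with S₀ added to the
-- list of vertex 2 (at most 5 = 3 + 2 colours), and extend.
colourPath (suc m) refl r s F ∣F₀∣≤ ∣F_L∣≤ inner left right =
  let S₀ , S₀⊆F₀ , S₀⟂F₁ , ∣S₀∣≡ = reservedPart (F 0) (F 1) r left
      ∣S₀∣≤3 = subst (_≤ 3) (sym ∣S₀∣≡) (reserved≤ 3 ∣F₀∣≤)
      tail = colourPath m refl 2 s (tailLists (F 2 ∪ S₀) F)
               (≤-trans (∣p∪q∣≤∣p∣+∣q∣ (F 2) S₀) (+-mono-≤ (≤-reflexive (inner 2 (s≤s z≤n) 2<L)) ∣S₀∣≤3))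
               ∣F_L∣≤
               (λ { zero () _ ; (suc i) _ i<L → inner (3 + i) (s≤s z≤n) (s≤s (s≤s i<L)) })
               (≤-trans (∣p∩q∣≤∣q∣ (F 2 ∪ S₀) (F 3)) (≤-reflexive (inner 3 (s≤s z≤n) 3<L)))
               (λ { zero () ; (suc i) i+1≡ → right (3 + i) (cong (2 +_) i+1≡) })
  in extendColouring F S₀ (inner 1 (s≤s z≤n) (s≤s (s≤s z≤n))) S₀⊆F₀ S₀⟂F₁ ∣S₀∣≡
       (≤-trans ∣S₀∣≤3 (s≤s (s≤s (s≤s z≤n)))) tail
  where
  2<L : 2 < 4 + double m
  2<L = s≤s (s≤s (s≤s z≤n))
  3<L : 3 < 4 + double m
  3<L = s≤s (s≤s (s≤s (s≤s z≤n)))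

double-suc : (m : ℕ) → suc (suc (double m)) ≡ 2 * suc m
double-suc zero    = refl
double-suc (suc m) = trans (cong (2 +_) (double-suc m)) (sym (*-suc 2 (suc m)))

extend : {n : ℕ} → (Fin n → Colours) → ℕ → Colours
extend {zero}  F i       = ⊥
extend {suc n} F zero    = F zero
extend {suc n} F (suc i) = extend (F ∘ suc) i

extend-toℕ : {n : ℕ} (F : Fin n → Colours) (i : Fin n) → extend F (toℕ i) ≡ F i
extend-toℕ F zero    = refl
extend-toℕ F (suc i) = extend-toℕ (F ∘ suc) i

extend-fromℕ : (n : ℕ) (F : Fin (suc n) → Colours) → extend F n ≡ F (fromℕ n)
extend-fromℕ n F = subst (λ j → extend F j ≡ F (fromℕ n)) (toℕ-fromℕ n) (extend-toℕ F (fromℕ n))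

extend-∀ : {n : ℕ} (F : Fin n → Colours) (P : ℕ → Colours → Set) →
  ((i : Fin n) → P (toℕ i) (F i)) → (j : ℕ) → j < n → P j (extend F j)
extend-∀ {suc n} F P P-F zero    _          = P-F zero
extend-∀ {suc n} F P P-F (suc j) (s≤s j<n) = extend-∀ (F ∘ suc) (P ∘ suc) (P-F ∘ suc) j j<n

restrict-avoiding : {n : ℕ} (F : Fin n → Colours) (f : ℕ → Colours) →
  ((i : ℕ) → Disjoint (f i) (extend F i)) → ((i : ℕ) → Disjoint (f i) (f (suc i))) →
  FAvoiding F (f ∘ toℕ)
restrict-avoiding F f avoidsF avoidsNext u v u~v =
  disjoint-∪ (subst (Disjoint (f (toℕ v))) (extend-toℕ F v) (avoidsF (toℕ v))) (neighbour u~v)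
  where
  neighbour : Adjacent u v → Disjoint (f (toℕ v)) (f (toℕ u))
  neighbour (inj₁ u+1≡v) =
    disjoint-sym (subst (λ j → Disjoint (f (toℕ u)) (f j)) (trans (+-comm 1 _) u+1≡v) (avoidsNext (toℕ u)))
  neighbour (inj₂ v+1≡u) =
    subst (λ j → Disjoint (f (toℕ v)) (f j)) (trans (+-comm 1 _) v+1≡u) (avoidsNext (toℕ v))

lemma18 : (k : ℕ) → 1 ≤ k → (r₁ r₂ₖ₊₁ : ℕ) → r₁ ≤ 2 → r₂ₖ₊₁ ≤ 2 →
    (F : Fin (suc (2 * k)) → Colours) →
    ∣ F zero ∣ ≤ 3 + r₁ →
    ∣ F (fromℕ (2 * k)) ∣ ≤ 3 + r₂ₖ₊₁ →
    ((i : Fin (suc (2 * k))) → 1 ≤ toℕ i → toℕ i < 2 * k → ∣ F i ∣ ≡ 2) →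
    ((i j : Fin (suc (2 * k))) → toℕ i ≡ 0 → toℕ j ≡ 1 → ∣ F i ∩ F j ∣ ≤ r₁) →
    ((i j : Fin (suc (2 * k))) → toℕ i + 1 ≡ 2 * k → toℕ j ≡ 2 * k → ∣ F i ∩ F j ∣ ≤ r₂ₖ₊₁) →
    Σ (Fin (suc (2 * k)) → Colours) λ f →
      FAvoiding F f
      × ((i : Fin (suc (2 * k))) → 1 ≤ toℕ i → toℕ i < 2 * k → ∣ f i ∣ ≡ 6)
      × (∣ f zero ∣ ≡ 8 ∸ r₁)
      × (∣ f (fromℕ (2 * k)) ∣ ≡ 8 ∸ r₂ₖ₊₁)
lemma18 zero ()
lemma18 (suc m) _ r s _ _ F ∣F₀∣≤ ∣F_N∣≤ inner left right =
  colour c ∘ toℕ , restrict-avoiding F (colour c) (avoidsList c) (avoidsNext c)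
  , (λ i → innerSize c (toℕ i)) , leftSize c
  , subst (λ j → ∣ colour c j ∣ ≡ 8 ∸ s) (sym (toℕ-fromℕ N)) (rightSize c)
  where
  N = 2 * suc m
  F-at-N : extend F N ≡ F (fromℕ N)
  F-at-N = extend-fromℕ N F
  c : PathColouring N r s (extend F)
  c = colourPath m (double-suc m) r s (extend F) ∣F₀∣≤
        (subst (λ X → ∣ X ∣ ≤ 3 + s) (sym F-at-N) ∣F_N∣≤)
        (λ i 1≤i i<N → extend-∀ F (λ j X → 1 ≤ j → j < N → ∣ X ∣ ≡ 2) inner i
                         (m<n⇒m<1+n i<N) 1≤i i<N)
        (left zero (suc zero) refl refl)
        (λ i i+1≡N → extend-∀ F (λ j X → j + 1 ≡ N → ∣ X ∩ extend F N ∣ ≤ s)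
           (λ i′ i′+1≡N → subst (λ Y → ∣ F i′ ∩ Y ∣ ≤ s) (sym F-at-N) (right i′ (fromℕ N) i′+1≡N (toℕ-fromℕ N)))
           i (m<n⇒m<1+n (≤-reflexive (trans (+-comm 1 i) i+1≡N))) i+1≡N)
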